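{- Let $G$ be a graph of order $n\ge 4$. Then $0\le \tau_{n-1}(G)+\tau_{n-1}(\bar G)\le 1$. Furthermore, $\tau_{n-1}(G)+\tau_{n-1}(\bar G)=1$ if and only if $G$ or $\bar G$ is complete, and $\tau_{n-1}(G)+\tau_{n-1}(\bar G)=0$ if and only if neither $G$ nor $\bar G$ is complete.
   Context: $\bar G$ is the complement of $G$. For $S\subseteq V(G)$ with $|S|\ge 2$, a pedant $S$-Steiner tree is a subgraph of $G$ that is a tree containing $S$ in which every vertex of $S$ has degree exactly one. Two pedant $S$-Steiner trees $T,T'$ are internally disjoint if $E(T)\cap E(T')=\emptyset$ and $V(T)\cap V(T')=S$. $\tau_G(S)$ is the maximum number of pairwise internally disjoint pedant $S$-Steiner trees in $G$, and $\tau_k(G)=\min\{\tau_G(S): S\subseteq V(G),\ |S|=k\}$; by convention $\tau_k(G)=0$ when $G$ is disconnected. -}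

module Defs where

open import Data.Nat using (ℕ; zero; suc; _+_; _≤_)
open import Data.Fin using (Fin; zero; suc; inject₁; fromℕ; _≟_)
open import Data.Fin.Subset using (Subset; _∈_; ∣_∣)
open import Data.Bool using (Bool; true; false; not; if_then_else_)
open import Data.Product using (Σ; ∃; _×_; _,_)
open import Data.Sum using (_⊎_)
open import Relation.Nullary using (¬_; does; yes; no)
open import Data.Empty using (⊥-elim)
open import Relation.Binary.PropositionalEquality using (_≡_; _≢_; refl; cong) renaming (sym to sym≡)
open import Function.Definitions using (Injective)
open import Function.Bundles using (_⇔_)

record Graph (n : ℕ) : Set where
  field
    adj   : Fin n → Fin n → Bool
    sym   : ∀ u v → adj u v ≡ adj v u
    irrefl : ∀ u → adj u u ≡ false
open Graph public

compAdj : ∀ {n} → Graph n → Fin n → Fin n → Bool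
compAdj G u v = if does (u ≟ v) then false else not (adj G u v)

compAdj-sym : ∀ {n} (G : Graph n) u v → compAdj G u v ≡ compAdj G v u
compAdj-sym G u v with u ≟ v | v ≟ u
... | yes _ | yes _ = refl
... | yes p | no q = ⊥-elim (q (sym≡ p))
... | no p | yes q = ⊥-elim (p (sym≡ q))
... | no _ | no _ = cong not (sym G u v)

compAdj-irrefl : ∀ {n} (G : Graph n) u → compAdj G u u ≡ false
compAdj-irrefl G u with u ≟ u
... | yes _ = refl
... | no p = ⊥-elim (p refl)

complement : ∀ {n} → Graph n → Graph n
complement G = record { adj = compAdj G ; sym = compAdj-sym G ; irrefl = compAdj-irrefl G }

data Walk {n : ℕ} (E : Fin n → Fin n → Bool) : Fin n → Fin n → Set where
  here : ∀ {u} → Walk E u u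
  step : ∀ {u w v} → E u w ≡ true → Walk E w v → Walk E u v

Connected : ∀ {n} → Graph n → Set
Connected G = ∀ u v → Walk (adj G) u v

Complete : ∀ {n} → Graph n → Set
Complete G = ∀ u v → u ≢ v → adj G u v ≡ true

record Subgraph {n : ℕ} (G : Graph n) : Set where
  field
    V : Fin n → Bool
    E : Fin n → Fin n → Bool
    E-sym : ∀ u v → E u v ≡ E v u
    E-adj : ∀ u v → E u v ≡ true → adj G u v ≡ true
    E-V   : ∀ u v → E u v ≡ true → V u ≡ true
open Subgraph public

-- A cycle in edge relation E: distinct vertices c₀,…,c_{m+2} (length ≥ 3),
-- consecutive ones adjacent, and the last adjacent to the first.
Cycle : ∀ {n} → (Fin n → Fin n → Bool) → Set
Cycle {n} E = Σ ℕ λ m → Σ (Fin (suc (suc (suc m))) → Fin n) λ c →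
  Injective _≡_ _≡_ c
  × (∀ (i : Fin (suc (suc m))) → E (c (inject₁ i)) (c (suc i)) ≡ true)
  × (E (c (fromℕ (suc (suc m)))) (c zero) ≡ true)

IsTree : ∀ {n} {G : Graph n} → Subgraph G → Set
IsTree T = (∀ u v → V T u ≡ true → V T v ≡ true → Walk (E T) u v) × ¬ Cycle (E T)

DegreeOne : ∀ {n} {G : Graph n} → Subgraph G → Fin n → Set
DegreeOne T v = Σ _ λ w → E T v w ≡ true × (∀ w' → E T v w' ≡ true → w' ≡ w)

PedantSteinerTree : ∀ {n} (G : Graph n) → Subset n → Subgraph G → Set
PedantSteinerTree G S T =
  IsTree T × (∀ v → v ∈ S → V T v ≡ true) × (∀ v → v ∈ S → DegreeOne T v)

InternallyDisjoint : ∀ {n} {G : Graph n} → Subset n → Subgraph G → Subgraph G → Set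
InternallyDisjoint S T T' =
  (∀ u v → E T u v ≡ true → E T' u v ≡ false)
  × (∀ v → (V T v ≡ true × V T' v ≡ true) ⇔ (v ∈ S))

HasTrees : ∀ {n} (G : Graph n) → Subset n → ℕ → Set
HasTrees G S t = Σ (Fin t → Subgraph G) λ T →
  (∀ i → PedantSteinerTree G S (T i))
  × (∀ i j → i ≢ j → InternallyDisjoint S (T i) (T j))

TauS : ∀ {n} (G : Graph n) → Subset n → ℕ → Set
TauS G S t = HasTrees G S t × ¬ HasTrees G S (suc t)

TauK : ∀ {n} (G : Graph n) → ℕ → ℕ → Set
TauK {n} G k t =
  (¬ Connected G × t ≡ 0)
  ⊎ (Connected G
     × (∀ S → ∣ S ∣ ≡ k → ∀ s → TauS G S s → t ≤ s)
     × Σ (Subset n) λ S → ∣ S ∣ ≡ k × TauS G S t)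

module Submission where

-- Let S = V ∖ {x}.  In a pedant S-Steiner tree T every terminal is a leaf,
-- and two adjacent terminals s, w would form a closed component {s, w} of T;
-- as S has a third vertex, this is impossible.  Hence the unique neighbour of
-- every terminal is the missing vertex x: T is the star centred at x.
-- Consequently two such trees always share the non-terminal x, so
-- τ_G(V ∖ {x}) ≤ 1, with equality exactly when x is adjacent to every other
-- vertex.  Minimising over x gives τ_{n−1}(G) = 1 if G is complete and
-- τ_{n−1}(G) = 0 otherwise; since G and Ḡ are never both complete, the
-- theorem is bookkeeping about two 0/1 values.

open import Defs hiding (sym)
open import Data.Nat using (ℕ; zero; suc; _+_; _∸_; _≤_; _<_; z≤n; s≤s)
open import Data.Nat.Properties using (n≮n; ≤-antisym; ≤-pred; ≤-trans; <-≤-trans; n≤0⇒n≡0; ≰⇒>; _≤?_)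
open import Data.Fin using (Fin; zero; suc; _≟_; inject≤; fromℕ; fromℕ<) renaming (_<_ to _<ᶠ_)
open import Data.Fin.Properties using (any?; all?; pigeonhole; inject≤-injective) renaming (<⇒≢ to <⇒≢ᶠ)
open import Data.Fin.Subset using (Subset; _∈_; _∉_; _⊆_; ∣_∣; ∁; ⁅_⁆; ⊤; _─_)
open import Data.Fin.Subset.Properties
  using (_∈?_; x∈⁅x⁆; x≢y⇒x∉⁅y⁆; x∉p⇒x∈∁p; x∈∁p⇒x∉p; ∣∁p∣≡n∸∣p∣; ∣⁅x⁆∣≡1;
         ∣⊤∣≡n; ∈⊤; ∣p∣≤n; p⊆q⇒∣p∣≤∣q∣; x∈p∩q⁺; x∈p∧x∉q⇒x∈p─q; p─q⊆p; p∩q≢∅⇒∣p─q∣<∣p∣)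
open import Data.Bool using (Bool; true; false; not; _xor_)
import Data.Bool.Properties as Bool
open import Data.Vec using ([]; _∷_; lookup)
open import Data.Product using (Σ; ∃; _×_; _,_; proj₁; proj₂)
open import Data.Sum using (_⊎_; inj₁; inj₂; [_,_]′; reduce)
open import Data.Empty using (⊥; ⊥-elim)
open import Function using (_∘_)
open import Function.Bundles using (_⇔_; mk⇔; Equivalence)
open import Relation.Nullary using (¬_; Dec; yes; no; does; contradiction; ¬?; map′)
open import Relation.Nullary.Decidable using (_×-dec_)
open import Relation.Binary.PropositionalEquality using (_≡_; _≢_; refl; sym; trans; cong; subst; subst₂)

-- Fewer than n prescribed vertices never exhaust Fin n: otherwise choosing
-- for every vertex an index naming it would be an injection Fin n → Fin k,
-- contradicting the pigeonhole principle.  (Used to find a third terminal.)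
fresh : ∀ {k n} → k < n → (v : Fin k → Fin n) → ∃ λ d → ∀ i → d ≢ v i
fresh k<n v with any? (λ d → all? (λ i → ¬? (d ≟ v i)))
... | yes avoiding = avoiding
... | no none = collision (pigeonhole k<n (proj₁ ∘ preimage))
  where
  preimage : ∀ d → ∃ λ i → d ≡ v i
  preimage d with any? (λ i → d ≟ v i)
  ... | yes hit = hit
  ... | no miss = ⊥-elim (none (d , λ i d≡vi → miss (i , d≡vi)))

  collision : (∃ λ d → ∃ λ d' → d <ᶠ d' × proj₁ (preimage d) ≡ proj₁ (preimage d')) →
              ∃ λ d → ∀ i → d ≢ v i
  collision (d , d' , d<d' , same) =
    contradiction (trans (proj₂ (preimage d)) (trans (cong v same) (sym (proj₂ (preimage d')))))
                  (<⇒≢ᶠ d<d')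

missingVertex : ∀ {n} → 1 ≤ n → (S : Subset n) → ∣ S ∣ ≡ n ∸ 1 → ∃ λ x → x ∉ S
missingVertex {suc n} _ S size with any? (λ x → ¬? (x ∈? S))
... | yes outside = outside
... | no none = contradiction tooLarge (n≮n n)
  where
  everything : ⊤ ⊆ S
  everything {x} _ with x ∈? S
  ... | yes x∈S = x∈S
  ... | no x∉S = ⊥-elim (none (x , x∉S))
  tooLarge : suc n ≤ n
  tooLarge = subst₂ _≤_ (∣⊤∣≡n (suc n)) size (p⊆q⇒∣p∣≤∣q∣ everything)

∣∁⁅x⁆∣ : ∀ {n} (x : Fin n) → ∣ ∁ ⁅ x ⁆ ∣ ≡ n ∸ 1
∣∁⁅x⁆∣ {n} x = trans (∣∁p∣≡n∸∣p∣ ⁅ x ⁆) (cong (n ∸_) (∣⁅x⁆∣≡1 x))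

∈∁⁅_⁆ : ∀ {n} (x : Fin n) {y} → y ≢ x → y ∈ ∁ ⁅ x ⁆
∈∁⁅ x ⁆ y≢x = x∉p⇒x∈∁p (x≢y⇒x∉⁅y⁆ y≢x)

∉∁⁅_⁆ : ∀ {n} (x : Fin n) → x ∉ ∁ ⁅ x ⁆
∉∁⁅ x ⁆ x∈ = x∈∁p⇒x∉p x∈ (x∈⁅x⁆ x)

-- Walks and connectivity

_++_ : ∀ {n} {E : Fin n → Fin n → Bool} {u v w} → Walk E u v → Walk E v w → Walk E u w
here ++ q = q
step e p ++ q = step e (p ++ q)

completeConnected : ∀ {n} (G : Graph n) → Complete G → Connected G
completeConnected G complete u v with u ≟ v
... | yes refl = here
... | no u≢v = step (complete u v u≢v) here

-- Connectivity is decidable (needed because τ_{n−1}(G) = 0 arises in two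
-- ways, according to whether G is connected).  We decide the existence of
-- walks whose vertices after the first lie in a set A, by recursion on ∣ A ∣:
-- a walk u → w → ⋯ → v can be shortened so that it never returns to w, and
-- then its tail is a walk within the smaller set A ∖ {w}.
module Reachability {n : ℕ} (E : Fin n → Fin n → Bool) where

  data WalkWithin (A : Subset n) : Fin n → Fin n → Set where
    here : ∀ {u} → WalkWithin A u u
    step : ∀ {u w v} → E u w ≡ true → w ∈ A → WalkWithin A w v → WalkWithin A u v

  weaken : ∀ {A B u v} → A ⊆ B → WalkWithin A u v → WalkWithin B u v
  weaken A⊆B here = here
  weaken A⊆B (step e w∈A rest) = step e (A⊆B w∈A) (weaken A⊆B rest)

  -- Cutting a walk at its last visit to x yields a walk avoiding x,
  -- starting either at the original start or at x.
  shortcut : ∀ {A y v} x → WalkWithin A y v → WalkWithin (A ─ ⁅ x ⁆) y v ⊎ WalkWithin (A ─ ⁅ x ⁆) x v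
  shortcut x here = inj₁ here
  shortcut x (step {w = w} e w∈A rest) with shortcut x rest
  ... | inj₂ fromX = inj₂ fromX
  ... | inj₁ fromW with w ≟ x
  ...   | yes refl = inj₂ fromW
  ...   | no w≢x = inj₁ (step e (x∈p∧x∉q⇒x∈p─q w∈A (x≢y⇒x∉⁅y⁆ w≢x)) fromW)

  -- k bounds ∣ A ∣ and makes the recursion structural
  walkWithin? : ∀ k A u v → ∣ A ∣ < k → Dec (WalkWithin A u v)
  walkWithin? (suc k) A u v bound with u ≟ v
  ... | yes refl = yes here
  ... | no u≢v = map′ fromFirstStep toFirstStep (any? firstStep?)
    where
    FirstStep : Fin n → Set
    FirstStep w = E u w ≡ true × w ∈ A × WalkWithin (A ─ ⁅ w ⁆) w v

    firstStep? : ∀ w → Dec (FirstStep w)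
    firstStep? w with w ∈? A
    ... | no w∉A = no (w∉A ∘ proj₁ ∘ proj₂)
    ... | yes w∈A = (E u w Bool.≟ true) ×-dec (yes w∈A ×-dec walkWithin? k (A ─ ⁅ w ⁆) w v smaller)
      where
      smaller : ∣ A ─ ⁅ w ⁆ ∣ < k
      smaller = <-≤-trans (p∩q≢∅⇒∣p─q∣<∣p∣ A ⁅ w ⁆ (w , x∈p∩q⁺ (w∈A , x∈⁅x⁆ w))) (≤-pred bound)

    fromFirstStep : ∃ FirstStep → WalkWithin A u v
    fromFirstStep (w , e , w∈A , rest) = step e w∈A (weaken (p─q⊆p A ⁅ w ⁆) rest)

    toFirstStep : WalkWithin A u v → ∃ FirstStep
    toFirstStep here = ⊥-elim (u≢v refl)
    toFirstStep (step {w = w} e w∈A rest) = w , e , w∈A , reduce (shortcut w rest)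

  forget : ∀ {A u v} → WalkWithin A u v → Walk E u v
  forget here = here
  forget (step e _ rest) = step e (forget rest)

  unrestricted : ∀ {u v} → Walk E u v → WalkWithin ⊤ u v
  unrestricted here = here
  unrestricted (step e rest) = step e ∈⊤ (unrestricted rest)

  walk? : ∀ u v → Dec (Walk E u v)
  walk? u v = map′ forget unrestricted (walkWithin? (suc n) ⊤ u v (s≤s (∣p∣≤n ⊤)))

connected? : ∀ {n} (G : Graph n) → Dec (Connected G)
connected? G = all? (λ u → all? (λ v → Reachability.walk? (adj G) u v))

-- Families of internally disjoint trees

noTrees : ∀ {n} (G : Graph n) S → HasTrees G S 0
noTrees G S = (λ ()) , (λ ()) , (λ ())

fewerTrees : ∀ {n} {G : Graph n} {S m k} → m ≤ k → HasTrees G S k → HasTrees G S m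
fewerTrees {m = m} {k} m≤k (T , pedant , disjoint) =
  T ∘ embed , pedant ∘ embed , λ i j i≢j → disjoint (embed i) (embed j) (i≢j ∘ inject≤-injective m≤k m≤k i j)
  where
  embed : Fin m → Fin k
  embed i = inject≤ i m≤k

tauS-bound : ∀ {n} {G : Graph n} {S t k} → TauS G S t → HasTrees G S k → k ≤ t
tauS-bound {t = t} {k} (_ , maximal) trees with k ≤? t
... | yes k≤t = k≤t
... | no k≰t = contradiction (fewerTrees (≰⇒> k≰t) trees) maximal

-- Pedant trees for the terminal set V ∖ {x}

-- Two adjacent terminals of a pedant S-Steiner tree are each other's only
-- neighbours, so they form a closed component and are the only terminals.
adjacentTerminals : ∀ {n} {G : Graph n} {S T} → PedantSteinerTree G S T →
  ∀ {s w} → s ∈ S → w ∈ S → E T s w ≡ true → ∀ {s'} → s' ∈ S → s' ≡ s ⊎ s' ≡ w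
adjacentTerminals {S = S} {T} ((connected , _) , inTree , leaf) {s} {w} s∈S w∈S s-w s'∈S =
  closed (inj₁ refl) (connected s _ (inTree s s∈S) (inTree _ s'∈S))
  where
  onlyNeighbour : ∀ {u u' z} → u ∈ S → E T u u' ≡ true → E T u z ≡ true → z ≡ u'
  onlyNeighbour u∈S u-u' u-z with leaf _ u∈S
  ... | (_ , _ , unique) = trans (unique _ u-z) (sym (unique _ u-u'))

  closed : ∀ {z y} → z ≡ s ⊎ z ≡ w → Walk (E T) z y → y ≡ s ⊎ y ≡ w
  closed atPair here = atPair
  closed (inj₁ refl) (step s-z rest) = closed (inj₂ (onlyNeighbour s∈S s-w s-z)) rest
  closed (inj₂ refl) (step w-z rest) = closed (inj₁ (onlyNeighbour w∈S (trans (E-sym T w s) s-w) w-z)) rest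

Universal : ∀ {n} → Graph n → Fin n → Set
Universal G x = ∀ v → v ≢ x → adj G v x ≡ true

completeUniversal : ∀ {n} (G : Graph n) → Complete G → ∀ x → Universal G x
completeUniversal G complete x v v≢x = complete v x v≢x

module AllButOne {n : ℕ} (n≥4 : 4 ≤ n) (G : Graph n) (x : Fin n) where

  -- Every terminal hangs on the missing vertex x: a third terminal besides
  -- s and a terminal neighbour w would contradict adjacentTerminals.
  terminalNeighbour : ∀ {T} → PedantSteinerTree G (∁ ⁅ x ⁆) T →
    ∀ {s w} → s ∈ ∁ ⁅ x ⁆ → E T s w ≡ true → w ≡ x
  terminalNeighbour {T} P {s} {w} s∈S s-w with w ≟ x
  ... | yes w≡x = w≡x
  ... | no w≢x with fresh n≥4 (lookup (x ∷ s ∷ w ∷ []))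
  ...   | (d , avoids) with adjacentTerminals {G = G} {S = ∁ ⁅ x ⁆} {T} P s∈S (∈∁⁅ x ⁆ w≢x) s-w (∈∁⁅ x ⁆ (avoids zero))
  ...     | inj₁ d≡s = ⊥-elim (avoids (suc zero) d≡s)
  ...     | inj₂ d≡w = ⊥-elim (avoids (suc (suc zero)) d≡w)

  -- Hence x lies on every pedant (V ∖ {x})-Steiner tree (as the neighbour of
  -- any terminal).
  centreInTree : ∀ {T} → PedantSteinerTree G (∁ ⁅ x ⁆) T → V T x ≡ true
  centreInTree {T} P with fresh (≤-trans (s≤s (s≤s z≤n)) n≥4) (λ (_ : Fin 1) → x)
  ... | (s , s≢x) with proj₂ (proj₂ P) s (∈∁⁅ x ⁆ (s≢x zero))
  ...   | (w , s-w , _) =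
    subst (λ z → V T z ≡ true) (terminalNeighbour {T} P (∈∁⁅ x ⁆ (s≢x zero)) s-w) (E-V T w s (trans (E-sym T w s) s-w))

  -- Two internally disjoint such trees would share the non-terminal x.
  atMostOneTree : ¬ HasTrees G (∁ ⁅ x ⁆) 2
  atMostOneTree (T , pedant , disjoint) =
    ∉∁⁅ x ⁆ (Equivalence.to (proj₂ (disjoint zero (suc zero) (λ ())) x)
                            (centreInTree {T zero} (pedant zero) , centreInTree {T (suc zero)} (pedant (suc zero))))

  treeMakesUniversal : HasTrees G (∁ ⁅ x ⁆) 1 → Universal G x
  treeMakesUniversal (T , pedant , _) v v≢x with proj₂ (proj₂ (pedant zero)) v (∈∁⁅ x ⁆ v≢x)
  ... | (w , v-w , _) =
    subst (λ z → adj G v z ≡ true) (terminalNeighbour {T zero} (pedant zero) (∈∁⁅ x ⁆ v≢x) v-w) (E-adj (T zero) v w v-w)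

-- Stars

module Star {n : ℕ} (G : Graph n) (x : Fin n) (universal : Universal G x) where

  isCentre : Fin n → Bool
  isCentre u = does (u ≟ x)

  -- an edge of the star has exactly one endpoint equal to the centre
  spoke : Fin n → Fin n → Bool
  spoke u v = isCentre u xor isCentre v

  spokeAtCentre : ∀ {u v} → spoke u v ≡ true → u ≡ x ⊎ v ≡ x
  spokeAtCentre {u} {v} e with u ≟ x | v ≟ x
  ... | yes u≡x | _ = inj₁ u≡x
  ... | no _ | yes v≡x = inj₂ v≡x
  spokeAtCentre () | no _ | no _

  spokeTo : ∀ {u} → u ≢ x → spoke u x ≡ true
  spokeTo {u} u≢x with u ≟ x | x ≟ x
  ... | yes u≡x | _ = ⊥-elim (u≢x u≡x)
  ... | no _ | yes _ = refl
  ... | no _ | no x≢x = ⊥-elim (x≢x refl)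

  spoke-sym : ∀ u v → spoke u v ≡ spoke v u
  spoke-sym u v = Bool.xor-comm (isCentre u) (isCentre v)

  spoke-adj : ∀ u v → spoke u v ≡ true → adj G u v ≡ true
  spoke-adj u v e with u ≟ x | v ≟ x
  spoke-adj u v () | yes _ | yes _
  ... | yes refl | no v≢x = trans (Graph.sym G x v) (universal v v≢x)
  ... | no u≢x | yes refl = universal u u≢x
  spoke-adj u v () | no _ | no _

  star : Subgraph G
  star = record { V = λ _ → true ; E = spoke ; E-sym = spoke-sym ; E-adj = spoke-adj ; E-V = λ _ _ _ → refl }

  toCentre : ∀ u → Walk spoke u x
  toCentre u with u ≟ x
  ... | yes refl = here
  ... | no u≢x = step (spokeTo u≢x) here

  fromCentre : ∀ v → Walk spoke x v
  fromCentre v with v ≟ x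
  ... | yes refl = here
  ... | no v≢x = step (trans (spoke-sym x v) (spokeTo v≢x)) here

  -- Consecutive edges c₀c₁, c₁c₂ of a cycle both meet the centre: either
  -- c₀ = x = c₂, or c₁ = x and then the closing edge meets x at c₀ or at the
  -- last vertex; all of these contradict injectivity.
  acyclic : ¬ Cycle spoke
  acyclic (m , c , injective , edges , closing) =
    centreTwice (spokeAtCentre (edges zero)) (spokeAtCentre (edges (suc zero))) (spokeAtCentre closing)
    where
    samePosition : ∀ {i j} → c i ≡ x → c j ≡ x → i ≡ j
    samePosition ci cj = injective (trans ci (sym cj))

    centreTwice : c zero ≡ x ⊎ c (suc zero) ≡ x → c (suc zero) ≡ x ⊎ c (suc (suc zero)) ≡ x →
                  c (fromℕ (suc (suc m))) ≡ x ⊎ c zero ≡ x → ⊥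
    centreTwice (inj₁ c₀) (inj₁ c₁) _ = contradiction (samePosition c₀ c₁) λ ()
    centreTwice (inj₁ c₀) (inj₂ c₂) _ = contradiction (samePosition c₀ c₂) λ ()
    centreTwice (inj₂ c₁) _ (inj₁ cₗ) = contradiction (samePosition cₗ c₁) λ ()
    centreTwice (inj₂ c₁) _ (inj₂ c₀) = contradiction (samePosition c₀ c₁) λ ()

  starIsPedant : ∀ S → x ∉ S → PedantSteinerTree G S star
  starIsPedant S x∉S = ((λ u v _ _ → toCentre u ++ fromCentre v) , acyclic) , (λ _ _ → refl) , leaf
    where
    leaf : ∀ s → s ∈ S → DegreeOne star s
    leaf s s∈S = x , spokeTo s≢x , onlyCentre
      where
      s≢x : s ≢ x
      s≢x refl = x∉S s∈S
      onlyCentre : ∀ w → spoke s w ≡ true → w ≡ x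
      onlyCentre w e with spokeAtCentre e
      ... | inj₁ s≡x = ⊥-elim (s≢x s≡x)
      ... | inj₂ w≡x = w≡x

  oneTree : ∀ S → x ∉ S → HasTrees G S 1
  oneTree S x∉S = (λ _ → star) , (λ _ → starIsPedant S x∉S) , λ { zero zero 0≢0 → ⊥-elim (0≢0 refl) }

tauS-universal : ∀ {n} → 4 ≤ n → (G : Graph n) (x : Fin n) → Universal G x → TauS G (∁ ⁅ x ⁆) 1
tauS-universal n≥4 G x universal =
  Star.oneTree G x universal (∁ ⁅ x ⁆) (∉∁⁅ x ⁆) , AllButOne.atMostOneTree n≥4 G x

tauS-nonUniversal : ∀ {n} → 4 ≤ n → (G : Graph n) {v x : Fin n} → v ≢ x → adj G v x ≡ false →
  TauS G (∁ ⁅ x ⁆) 0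
tauS-nonUniversal n≥4 G {v} {x} v≢x v-x =
  noTrees G (∁ ⁅ x ⁆) ,
  λ tree → contradiction (trans (sym (AllButOne.treeMakesUniversal n≥4 G x tree v v≢x)) v-x) λ ()

NonEdge : ∀ {n} → Graph n → Set
NonEdge G = ∃ λ u → ∃ λ v → u ≢ v × adj G u v ≡ false

nonEdge⇒incomplete : ∀ {n} (G : Graph n) → NonEdge G → ¬ Complete G
nonEdge⇒incomplete G (u , v , u≢v , u-v) complete = contradiction (trans (sym (complete u v u≢v)) u-v) λ ()

completeOrNonEdge : ∀ {n} (G : Graph n) → Complete G ⊎ NonEdge G
completeOrNonEdge G with any? (λ u → any? (λ v → ¬? (u ≟ v) ×-dec (adj G u v Bool.≟ false)))
... | yes nonEdge = inj₂ nonEdge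
... | no none = inj₁ λ u v u≢v → Bool.¬-not (λ u-v → none (u , v , u≢v , u-v))

module TauAllButOne {n : ℕ} (n≥4 : 4 ≤ n) (G : Graph n) where

  n≥1 : 1 ≤ n
  n≥1 = ≤-trans (s≤s z≤n) n≥4

  x₀ : Fin n
  x₀ = fromℕ< {0} n≥1

  -- If G is complete, every set of n − 1 terminals misses a vertex, the
  -- centre of a star; hence τ_G(S) ≥ 1 for all such S.
  atLeastOneTree : Complete G → ∀ S → ∣ S ∣ ≡ n ∸ 1 → ∀ t → TauS G S t → 1 ≤ t
  atLeastOneTree complete S size t tauS with missingVertex n≥1 S size
  ... | (x , x∉S) = tauS-bound tauS (Star.oneTree G x (completeUniversal G complete x) S x∉S)

  tauK-complete : Complete G → TauK G (n ∸ 1) 1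
  tauK-complete complete =
    inj₂ (completeConnected G complete , atLeastOneTree complete ,
          ∁ ⁅ x₀ ⁆ , ∣∁⁅x⁆∣ x₀ , tauS-universal n≥4 G x₀ (completeUniversal G complete x₀))

  tauK-complete-unique : Complete G → ∀ {t} → TauK G (n ∸ 1) t → t ≡ 1
  tauK-complete-unique complete (inj₁ (disconnected , _)) = ⊥-elim (disconnected (completeConnected G complete))
  tauK-complete-unique complete (inj₂ (_ , minimal , S , size , tauS)) =
    ≤-antisym (minimal (∁ ⁅ x₀ ⁆) (∣∁⁅x⁆∣ x₀) 1 (tauS-universal n≥4 G x₀ (completeUniversal G complete x₀)))
              (atLeastOneTree complete S size _ tauS)

  -- For a non-edge uv the terminal set V ∖ {v} admits no tree at all, so
  -- τ_{n−1}(G) = 0 whether or not G is connected.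
  tauK-nonEdge : NonEdge G → TauK G (n ∸ 1) 0
  tauK-nonEdge (u , v , u≢v , u-v) with connected? G
  ... | no disconnected = inj₁ (disconnected , refl)
  ... | yes connected =
    inj₂ (connected , (λ _ _ _ _ → z≤n) , ∁ ⁅ v ⁆ , ∣∁⁅x⁆∣ v , tauS-nonUniversal n≥4 G u≢v u-v)

  tauK-nonEdge-unique : NonEdge G → ∀ {t} → TauK G (n ∸ 1) t → t ≡ 0
  tauK-nonEdge-unique _ (inj₁ (_ , t≡0)) = t≡0
  tauK-nonEdge-unique (u , v , u≢v , u-v) (inj₂ (_ , minimal , _)) =
    n≤0⇒n≡0 (minimal (∁ ⁅ v ⁆) (∣∁⁅x⁆∣ v) 0 (tauS-nonUniversal n≥4 G u≢v u-v))

  tauK-exists : ∃ (TauK G (n ∸ 1))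
  tauK-exists with completeOrNonEdge G
  ... | inj₁ complete = 1 , tauK-complete complete
  ... | inj₂ nonEdge = 0 , tauK-nonEdge nonEdge

  tauK-value : ∀ {t} → TauK G (n ∸ 1) t → (Complete G × t ≡ 1) ⊎ (¬ Complete G × t ≡ 0)
  tauK-value tauK with completeOrNonEdge G
  ... | inj₁ complete = inj₁ (complete , tauK-complete-unique complete tauK)
  ... | inj₂ nonEdge = inj₂ (nonEdge⇒incomplete G nonEdge , tauK-nonEdge-unique nonEdge tauK)

-- Any two distinct vertices are adjacent in exactly one of G and Ḡ.
notBothComplete : ∀ {n} → 2 ≤ n → (G : Graph n) → Complete G → ¬ Complete (complement G)
notBothComplete {suc (suc _)} (s≤s (s≤s z≤n)) G complete complete' =
  contradiction (trans (sym (cong not (complete zero (suc zero) λ ()))) (complete' zero (suc zero) λ ())) λ ()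

indicatorSum : ∀ {P Q : Set} {t₁ t₂ : ℕ} → ¬ (P × Q) →
  (P × t₁ ≡ 1) ⊎ (¬ P × t₁ ≡ 0) → (Q × t₂ ≡ 1) ⊎ (¬ Q × t₂ ≡ 0) →
  (0 ≤ t₁ + t₂ × t₁ + t₂ ≤ 1) × ((t₁ + t₂ ≡ 1) ⇔ (P ⊎ Q)) × ((t₁ + t₂ ≡ 0) ⇔ (¬ P × ¬ Q))
indicatorSum incompatible (inj₁ (p , refl)) (inj₁ (q , refl)) = ⊥-elim (incompatible (p , q))
indicatorSum _ (inj₁ (p , refl)) (inj₂ (_ , refl)) =
  (z≤n , s≤s z≤n) , mk⇔ (λ _ → inj₁ p) (λ _ → refl) , mk⇔ (λ ()) (λ (¬p , _) → ⊥-elim (¬p p))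
indicatorSum _ (inj₂ (_ , refl)) (inj₁ (q , refl)) =
  (z≤n , s≤s z≤n) , mk⇔ (λ _ → inj₂ q) (λ _ → refl) , mk⇔ (λ ()) (λ (_ , ¬q) → ⊥-elim (¬q q))
indicatorSum _ (inj₂ (¬p , refl)) (inj₂ (¬q , refl)) =
  (z≤n , z≤n) , mk⇔ (λ ()) (⊥-elim ∘ [ ¬p , ¬q ]′) , mk⇔ (λ _ → ¬p , ¬q) (λ _ → refl)

mainTheorem17 : (n : ℕ) → 4 ≤ n → (G : Graph n) →
    (Σ ℕ λ t₁ → Σ ℕ λ t₂ → TauK G (n ∸ 1) t₁ × TauK (complement G) (n ∸ 1) t₂)
    × (∀ t₁ t₂ → TauK G (n ∸ 1) t₁ → TauK (complement G) (n ∸ 1) t₂ →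
        (0 ≤ t₁ + t₂ × t₁ + t₂ ≤ 1)
        × ((t₁ + t₂ ≡ 1) ⇔ (Complete G ⊎ Complete (complement G)))
        × ((t₁ + t₂ ≡ 0) ⇔ (¬ Complete G × ¬ Complete (complement G))))
mainTheorem17 n n≥4 G =
  (proj₁ T.tauK-exists , proj₁ Tᶜ.tauK-exists , proj₂ T.tauK-exists , proj₂ Tᶜ.tauK-exists) ,
  λ t₁ t₂ tauK tauKᶜ →
    indicatorSum (λ (complete , complete') → notBothComplete (≤-trans (s≤s (s≤s z≤n)) n≥4) G complete complete')
                 (T.tauK-value tauK) (Tᶜ.tauK-value tauKᶜ)
  where
  module T = TauAllButOne n≥4 G
  module Tᶜ = TauAllButOne n≥4 (complement G)
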